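{- Let $P(\mathbf{X})=\mathbf{A}_0+\sum_{i=1}^{m}\mathbf{A}_i\mathbf{X}^i$ be a polynomial whose coefficients are finite forests, let $d_{\max}=\max_{i>0}\mathrm{depth}(\mathbf{A}_i)$, and assume $\mathrm{depth}(\mathbf{A}_0)\le d_{\max}$. Then $P$ is injective on the semiring of finite forests of depth at most $d_{\max}$: for all finite forests $\mathbf{X},\mathbf{Y}$ of depth at most $d_{\max}$, $P(\mathbf{X})=P(\mathbf{Y})$ implies $\mathbf{X}=\mathbf{Y}$.
   Context: A tree is a finite rooted in-tree (arcs directed from leaves towards the root), considered up to isomorphism; a forest is a finite multiset (disjoint union) of trees. The depth of a node is its distance to the root; the depth of a tree is the maximal depth of its nodes, and the depth of a forest the maximal depth of its trees. The sum of forests is disjoint union. The product of two trees $t_1=(V_1,E_1)$, $t_2=(V_2,E_2)$ is the tree with node set $\{(v,u)\in V_1\times V_2:\mathrm{depth}(v)=\mathrm{depth}(u)\}$ and arcs $((v,u),(v',u'))$ whenever $(v,v')\in E_1$ and $(u,u')\in E_2$ (so its depth is the minimum of the two depths); the product of forests is the sum of the products of their trees, and $\mathbf{X}^i$ is the $i$-fold product. -}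

module Defs where

open import Data.Nat using (ℕ; zero; suc; _≤_; _⊔_)
open import Data.List using (List; []; _∷_; _++_)
open import Data.Maybe using (Maybe; nothing; just)
open import Data.List.Relation.Binary.Permutation.Homogeneous using (Permutation)

-- A finite rooted tree, given by the (unordered, but represented as a list)
-- collection of subtrees hanging below its root.
data Tree : Set where
  node : List Tree → Tree

Forest : Set
Forest = List Tree

data _≅_ : Tree → Tree → Set where
  node : ∀ {ts us} → Permutation _≅_ ts us → node ts ≅ node us

_≋_ : Forest → Forest → Set
F ≋ G = Permutation _≅_ F G

infix 4 _≅_ _≋_

mutual
  tdepth : Tree → ℕ
  tdepth (node ts) = childDepth ts

  childDepth : List Tree → ℕ
  childDepth []       = 0
  childDepth (t ∷ ts) = suc (tdepth t) ⊔ childDepth ts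

-- Extended naturals ℕ ∪ {-∞}: nothing = -∞ (depth of the empty forest).
ℕ⊥ : Set
ℕ⊥ = Maybe ℕ

_⊔⊥_ : ℕ⊥ → ℕ⊥ → ℕ⊥
nothing ⊔⊥ n      = n
just m  ⊔⊥ nothing = just m
just m  ⊔⊥ just n  = just (m ⊔ n)

data _≤⊥_ : ℕ⊥ → ℕ⊥ → Set where
  -∞≤   : ∀ {n} → nothing ≤⊥ n
  just≤ : ∀ {m n} → m ≤ n → just m ≤⊥ just n

infix 4 _≤⊥_

fdepth : Forest → ℕ⊥
fdepth []       = nothing
fdepth (t ∷ ts) = just (tdepth t) ⊔⊥ fdepth ts

-- Product of trees: pairs of nodes at equal depth; the children of (v,u)
-- are the pairs (v',u') of children.
mutual
  _⊗_ : Tree → Tree → Tree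
  node ts ⊗ node us = node (prodL ts us)

  prodL : List Tree → List Tree → List Tree
  prodL []       us = []
  prodL (t ∷ ts) us = prodR t us ++ prodL ts us

  prodR : Tree → List Tree → List Tree
  prodR t []       = []
  prodR t (u ∷ us) = (t ⊗ u) ∷ prodR t us

-- Sum of forests = disjoint union (++); product of forests:
_⊛_ : Forest → Forest → Forest
F ⊛ G = prodL F G

-- pow X k = X^(k+1)
pow : Forest → ℕ → Forest
pow X zero    = X
pow X (suc k) = X ⊛ pow X k

-- Σ_{i} A_i X^i where the j-th (0-based) entry of the list is the
-- coefficient of X^(k+j+1).
polyFrom : ℕ → List Forest → Forest → Forest
polyFrom k []       X = []
polyFrom k (A ∷ As) X = (A ⊛ pow X k) ++ polyFrom (suc k) As X

-- P(X) = A₀ + Σ_{i=1}^{m} A_i X^i, with As = [A₁, …, A_m].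
evalPoly : Forest → List Forest → Forest → Forest
evalPoly A₀ As X = A₀ ++ polyFrom 0 As X

dmax : List Forest → ℕ⊥
dmax []       = nothing
dmax (A ∷ As) = fdepth A ⊔⊥ dmax As

-- For a tree S, the number hom(S, –) of depth-preserving homomorphisms from S
-- is additive on sums and multiplicative on products of forests, so
-- hom(S, P(X)) = hom(S, A₀) + p(hom(S, X)) for the polynomial p over ℕ with
-- coefficients hom(S, Aᵢ). If some Aᵢ has a tree at least as deep as S then p is
-- strictly increasing; otherwise all trees of X and Y are shallower than S and
-- hom(S, X) = hom(S, Y) = 0. So P(X) ≋ P(Y) forces hom(S, X) = hom(S, Y) for all S,
-- and these counts determine the forest: a tree t of X without a copy in Y is
-- told apart from each tree of Y by some count hom(Sᵢ, –), and the square of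
-- ∏ᵢ (hom(Sᵢ, –) − hom(Sᵢ, yᵢ)) is an integer combination of counts (gluing roots
-- multiplies counts) whose sum is positive over X but zero over Y.

module Submission where

open import Defs
open import Data.Empty using (⊥-elim)
open import Data.Integer.Base as ℤ using (ℤ; +_; +[1+_]; -[1+_]; 0ℤ; 1ℤ)
import Data.Integer.Properties as ℤ
open import Data.Integer.Tactic.RingSolver using (solve-∀)
open import Data.List using (List; []; _∷_; _++_; map)
open import Data.List.Relation.Binary.Permutation.Homogeneous using (Permutation; refl; prep; swap; trans)
open import Data.List.Relation.Binary.Pointwise.Base using (Pointwise; []; _∷_)
open import Data.List.Relation.Unary.All as All using (All; []; _∷_)
open import Data.List.Relation.Unary.Any as Any using (Any; here; there)
import Data.List.Relation.Unary.Any.Properties as Any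
open import Data.Maybe using (just; nothing)
open import Data.Nat.Base
  using (ℕ; zero; suc; _+_; _*_; _^_; _≤_; _<_; _⊔_; z≤n; s≤s; s≤s⁻¹; >-nonZero)
open import Data.Nat.Properties
open import Algebra.Properties.CommutativeSemigroup *-commutativeSemigroup using (interchange)
open import Algebra.Properties.CommutativeSemigroup +-commutativeSemigroup using (x∙yz≈y∙xz)
open import Data.Product using (Σ-syntax; _×_; _,_)
open import Data.Sum using (_⊎_; inj₁; inj₂)
open import Relation.Binary.Definitions using (tri<; tri≈; tri>)
open import Relation.Binary.PropositionalEquality
  using (_≡_; _≢_; cong; cong₂; subst; sym; module ≡-Reasoning)
  renaming (refl to ≡-refl; trans to ≡-trans)
open import Relation.Nullary using (Dec; yes; no; ¬_)
import Relation.Nullary.Decidable as Dec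
open ≡-Reasoning

mutual
  ≅-refl : ∀ t → t ≅ t
  ≅-refl (node ts) = node (refl (≅-pointwise-refl ts))

  ≅-pointwise-refl : ∀ ts → Pointwise _≅_ ts ts
  ≅-pointwise-refl []       = []
  ≅-pointwise-refl (t ∷ ts) = ≅-refl t ∷ ≅-pointwise-refl ts

≋-refl : ∀ X → X ≋ X
≋-refl X = refl (≅-pointwise-refl X)

-- hom S t counts the depth-preserving homomorphisms from S to t: the root goes
-- to the root and each child subtree of S goes into some child subtree of t.
mutual
  hom : Tree → Tree → ℕ
  hom (node ss) (node ts) = homEach ss ts

  homEach : List Tree → Forest → ℕ
  homEach []       ts = 1
  homEach (s ∷ ss) ts = homInto s ts * homEach ss ts

  homInto : Tree → Forest → ℕ
  homInto s []       = 0
  homInto s (t ∷ ts) = hom s t + homInto s ts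

homInto-++ : ∀ S X Y → homInto S (X ++ Y) ≡ homInto S X + homInto S Y
homInto-++ S []      Y = ≡-refl
homInto-++ S (x ∷ X) Y =
  ≡-trans (cong (λ n → hom S x + n) (homInto-++ S X Y)) (sym (+-assoc (hom S x) (homInto S X) (homInto S Y)))

homEach-++ : ∀ ss ss′ ts → homEach (ss ++ ss′) ts ≡ homEach ss ts * homEach ss′ ts
homEach-++ []       ss′ ts = sym (+-identityʳ _)
homEach-++ (s ∷ ss) ss′ ts =
  ≡-trans (cong (homInto s ts *_) (homEach-++ ss ss′ ts)) (sym (*-assoc (homInto s ts) _ _))

mutual
  hom-⊗ : ∀ S t u → hom S (t ⊗ u) ≡ hom S t * hom S u
  hom-⊗ (node ss) (node ts) (node us) = homEach-⊛ ss ts us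

  homEach-⊛ : ∀ ss ts us → homEach ss (ts ⊛ us) ≡ homEach ss ts * homEach ss us
  homEach-⊛ []       ts us = ≡-refl
  homEach-⊛ (s ∷ ss) ts us = begin
    homInto s (ts ⊛ us) * homEach ss (ts ⊛ us)
      ≡⟨ cong₂ _*_ (homInto-⊛ s ts us) (homEach-⊛ ss ts us) ⟩
    (homInto s ts * homInto s us) * (homEach ss ts * homEach ss us)
      ≡⟨ interchange (homInto s ts) (homInto s us) (homEach ss ts) (homEach ss us) ⟩
    (homInto s ts * homEach ss ts) * (homInto s us * homEach ss us) ∎

  homInto-⊛ : ∀ S X Y → homInto S (X ⊛ Y) ≡ homInto S X * homInto S Y
  homInto-⊛ S []      Y = ≡-refl
  homInto-⊛ S (x ∷ X) Y = begin
    homInto S (prodR x Y ++ prodL X Y)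
      ≡⟨ homInto-++ S (prodR x Y) (prodL X Y) ⟩
    homInto S (prodR x Y) + homInto S (X ⊛ Y)
      ≡⟨ cong₂ _+_ (homInto-prodR S x Y) (homInto-⊛ S X Y) ⟩
    hom S x * homInto S Y + homInto S X * homInto S Y
      ≡⟨ *-distribʳ-+ (homInto S Y) (hom S x) (homInto S X) ⟨
    (hom S x + homInto S X) * homInto S Y ∎

  homInto-prodR : ∀ S x Y → homInto S (prodR x Y) ≡ hom S x * homInto S Y
  homInto-prodR S x []      = sym (*-zeroʳ (hom S x))
  homInto-prodR S x (y ∷ Y) = begin
    hom S (x ⊗ y) + homInto S (prodR x Y)     ≡⟨ cong₂ _+_ (hom-⊗ S x y) (homInto-prodR S x Y) ⟩
    hom S x * hom S y + hom S x * homInto S Y ≡⟨ *-distribˡ-+ (hom S x) (hom S y) (homInto S Y) ⟨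
    hom S x * (hom S y + homInto S Y)         ∎

homInto-pow : ∀ S X k → homInto S (pow X k) ≡ homInto S X ^ suc k
homInto-pow S X zero    = sym (*-identityʳ (homInto S X))
homInto-pow S X (suc k) = ≡-trans (homInto-⊛ S X (pow X k)) (cong (homInto S X *_) (homInto-pow S X k))

mutual
  hom-cong : ∀ S {t u} → t ≅ u → hom S t ≡ hom S u
  hom-cong (node ss) (node ts≋us) = homEach-cong ss ts≋us

  homEach-cong : ∀ ss {ts us} → ts ≋ us → homEach ss ts ≡ homEach ss us
  homEach-cong []       _     = ≡-refl
  homEach-cong (s ∷ ss) ts≋us = cong₂ _*_ (homInto-cong s ts≋us) (homEach-cong ss ts≋us)

  homInto-cong : ∀ S {X Y} → X ≋ Y → homInto S X ≡ homInto S Y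
  homInto-cong S (refl X≈Y)          = homInto-pointwise S X≈Y
  homInto-cong S (prep x≅y X≋Y)      = cong₂ _+_ (hom-cong S x≅y) (homInto-cong S X≋Y)
  homInto-cong S (swap {ys = Y} {x′ = x′} {y′ = y′} x≅x′ y≅y′ X≋Y) =
    ≡-trans (cong₂ _+_ (hom-cong S x≅x′) (cong₂ _+_ (hom-cong S y≅y′) (homInto-cong S X≋Y)))
            (x∙yz≈y∙xz (hom S x′) (hom S y′) (homInto S Y))
  homInto-cong S (trans X≋Y Y≋Z)     = ≡-trans (homInto-cong S X≋Y) (homInto-cong S Y≋Z)

  homInto-pointwise : ∀ S {X Y} → Pointwise _≅_ X Y → homInto S X ≡ homInto S Y
  homInto-pointwise S []           = ≡-refl
  homInto-pointwise S (x≅y ∷ X≈Y) = cong₂ _+_ (hom-cong S x≅y) (homInto-pointwise S X≈Y)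

Separable : Forest → Forest → Set
Separable X Y = Σ[ S ∈ Tree ] homInto S X ≢ homInto S Y

Separableᵗ : Tree → Tree → Set
Separableᵗ t u = Σ[ S ∈ Tree ] hom S t ≢ hom S u

leaf : Tree
leaf = node []

hom-leaf : ∀ t → hom leaf t ≡ 1
hom-leaf (node ts) = ≡-refl

plant : Tree → Tree
plant S = node (S ∷ [])

hom-plant : ∀ S ts → hom (plant S) (node ts) ≡ homInto S ts
hom-plant S ts = *-identityʳ (homInto S ts)

glue : Tree → Tree → Tree
glue (node ss) (node ss′) = node (ss ++ ss′)

hom-glue : ∀ S S′ t → hom (glue S S′) t ≡ hom S t * hom S′ t
hom-glue (node ss) (node ss′) (node ts) = homEach-++ ss ss′ ts

∑ : Forest → (Tree → ℤ) → ℤ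
∑ []      f = 0ℤ
∑ (t ∷ X) f = f t ℤ.+ ∑ X f

∑-cong : ∀ X {f g} → (∀ t → f t ≡ g t) → ∑ X f ≡ ∑ X g
∑-cong []      f≗g = ≡-refl
∑-cong (t ∷ X) f≗g = cong₂ ℤ._+_ (f≗g t) (∑-cong X f≗g)

∑-linear : ∀ X f g k → ∑ X (λ t → f t ℤ.- k ℤ.* g t) ≡ ∑ X f ℤ.- k ℤ.* ∑ X g
∑-linear []      f g k = vanish k
  where
  vanish : ∀ k → 0ℤ ≡ 0ℤ ℤ.- k ℤ.* 0ℤ
  vanish = solve-∀
∑-linear (t ∷ X) f g k = begin
  (f t ℤ.- k ℤ.* g t) ℤ.+ ∑ X (λ u → f u ℤ.- k ℤ.* g u)
    ≡⟨ cong (λ s → (f t ℤ.- k ℤ.* g t) ℤ.+ s) (∑-linear X f g k) ⟩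
  (f t ℤ.- k ℤ.* g t) ℤ.+ (∑ X f ℤ.- k ℤ.* ∑ X g)
    ≡⟨ regroup (f t) (g t) (∑ X f) (∑ X g) k ⟩
  (f t ℤ.+ ∑ X f) ℤ.- k ℤ.* (g t ℤ.+ ∑ X g) ∎
  where
  regroup : ∀ a b A B k → (a ℤ.- k ℤ.* b) ℤ.+ (A ℤ.- k ℤ.* B) ≡ (a ℤ.+ A) ℤ.- k ℤ.* (b ℤ.+ B)
  regroup = solve-∀

∑-hom : ∀ S X → ∑ X (λ t → + hom S t) ≡ + homInto S X
∑-hom S []      = ≡-refl
∑-hom S (t ∷ X) =
  ≡-trans (cong (λ s → + hom S t ℤ.+ s) (∑-hom S X)) (sym (ℤ.pos-+ (hom S t) (homInto S X)))

∑-zero : ∀ {f} Y → All (λ u → f u ≡ 0ℤ) Y → ∑ Y f ≡ 0ℤ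
∑-zero []      []             = ≡-refl
∑-zero (u ∷ Y) (fu≡0 ∷ fY≡0) = cong₂ ℤ._+_ fu≡0 (∑-zero Y fY≡0)

∑-nonNegative : ∀ {f} X → (∀ u → 0ℤ ℤ.≤ f u) → 0ℤ ℤ.≤ ∑ X f
∑-nonNegative []      f≥0 = ℤ.≤-refl
∑-nonNegative (u ∷ X) f≥0 = ℤ.+-mono-≤ (f≥0 u) (∑-nonNegative X f≥0)

square-nonNegative : ∀ i → 0ℤ ℤ.≤ i ℤ.* i
square-nonNegative (+ zero)  = ℤ.≤-refl
square-nonNegative +[1+ n ]  = ℤ.+≤+ z≤n
square-nonNegative -[1+ n ]  = ℤ.+≤+ z≤n

square-positive : ∀ i → i ≢ 0ℤ → 0ℤ ℤ.< i ℤ.* i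
square-positive (+ zero) i≢0 = ⊥-elim (i≢0 ≡-refl)
square-positive +[1+ n ] _   = ℤ.+<+ (s≤s z≤n)
square-positive -[1+ n ] _   = ℤ.+<+ (s≤s z≤n)

SumsAgree : Forest → Forest → (Tree → ℤ) → Set
SumsAgree X Y f = ∑ X f ≡ ∑ Y f

sumsAgree-cong : ∀ X Y {f g} → (∀ t → f t ≡ g t) → SumsAgree X Y g → SumsAgree X Y f
sumsAgree-cong X Y f≗g agree = ≡-trans (∑-cong X f≗g) (≡-trans agree (sym (∑-cong Y f≗g)))

sumsAgree-linear : ∀ X Y {f g} k → SumsAgree X Y f → SumsAgree X Y g →
                   SumsAgree X Y (λ t → f t ℤ.- k ℤ.* g t)
sumsAgree-linear X Y {f} {g} k f-agree g-agree = begin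
  ∑ X (λ t → f t ℤ.- k ℤ.* g t) ≡⟨ ∑-linear X f g k ⟩
  ∑ X f ℤ.- k ℤ.* ∑ X g         ≡⟨ cong₂ (λ a b → a ℤ.- k ℤ.* b) f-agree g-agree ⟩
  ∑ Y f ℤ.- k ℤ.* ∑ Y g         ≡⟨ ∑-linear Y f g k ⟨
  ∑ Y (λ t → f t ℤ.- k ℤ.* g t) ∎

selector : List (Tree × ℕ) → Tree → ℤ
selector []             t = 1ℤ
selector ((S , c) ∷ gs) t = (+ hom S t ℤ.- + c) ℤ.* selector gs t

selector-++ : ∀ gs hs t → selector (gs ++ hs) t ≡ selector gs t ℤ.* selector hs t
selector-++ []             hs t = sym (ℤ.*-identityˡ (selector hs t))
selector-++ ((S , c) ∷ gs) hs t =
  ≡-trans (cong ((+ hom S t ℤ.- + c) ℤ.*_) (selector-++ gs hs t))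
          (sym (ℤ.*-assoc (+ hom S t ℤ.- + c) (selector gs t) (selector hs t)))

weighted : Tree → List (Tree × ℕ) → Tree → ℤ
weighted F gs t = + hom F t ℤ.* selector gs t

weighted-∷ : ∀ F S c gs t →
             weighted F ((S , c) ∷ gs) t ≡ weighted (glue F S) gs t ℤ.- + c ℤ.* weighted F gs t
weighted-∷ F S c gs t = begin
  + hom F t ℤ.* ((+ hom S t ℤ.- + c) ℤ.* selector gs t)
    ≡⟨ expand (+ hom F t) (+ hom S t) (+ c) (selector gs t) ⟩
  (+ hom F t ℤ.* + hom S t) ℤ.* selector gs t ℤ.- + c ℤ.* weighted F gs t
    ≡⟨ cong (λ h → h ℤ.* selector gs t ℤ.- + c ℤ.* weighted F gs t) glued ⟩
  weighted (glue F S) gs t ℤ.- + c ℤ.* weighted F gs t ∎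
  where
  expand : ∀ a b c p → a ℤ.* ((b ℤ.- c) ℤ.* p) ≡ (a ℤ.* b) ℤ.* p ℤ.- c ℤ.* (a ℤ.* p)
  expand = solve-∀
  glued : + hom F t ℤ.* + hom S t ≡ + hom (glue F S) t
  glued = ≡-trans (sym (ℤ.pos-* (hom F t) (hom S t))) (cong +_ (sym (hom-glue F S t)))

separable⊎weighted-sumsAgree : ∀ X Y gs F → Separable X Y ⊎ SumsAgree X Y (weighted F gs)
separable⊎weighted-sumsAgree X Y [] F with homInto F X ≟ homInto F Y
... | no  F-separates = inj₁ (F , F-separates)
... | yes F-agrees    = inj₂ (sumsAgree-cong X Y (λ t → ℤ.*-identityʳ (+ hom F t)) (begin
  ∑ X (λ t → + hom F t) ≡⟨ ∑-hom F X ⟩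
  + homInto F X         ≡⟨ cong +_ F-agrees ⟩
  + homInto F Y         ≡⟨ ∑-hom F Y ⟨
  ∑ Y (λ t → + hom F t) ∎))
separable⊎weighted-sumsAgree X Y ((S , c) ∷ gs) F
  with separable⊎weighted-sumsAgree X Y gs (glue F S) | separable⊎weighted-sumsAgree X Y gs F
... | inj₁ sep    | _           = inj₁ sep
... | inj₂ _      | inj₁ sep    = inj₁ sep
... | inj₂ agree₁ | inj₂ agree₂ =
  inj₂ (sumsAgree-cong X Y (weighted-∷ F S c gs) (sumsAgree-linear X Y (+ c) agree₁ agree₂))

separators : ∀ {t Y} → All (Separableᵗ t) Y → List (Tree × ℕ)
separators []                         = []
separators {Y = u ∷ _} ((S , _) ∷ seps) = (S , hom S u) ∷ separators seps

separators-vanish : ∀ {t} Y (seps : All (Separableᵗ t) Y) →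
                    All (λ u → selector (separators seps) u ≡ 0ℤ) Y
separators-vanish []      []               = []
separators-vanish (u ∷ Y) ((S , _) ∷ seps) =
  cong (ℤ._* selector (separators seps) u) (ℤ.+-inverseʳ (+ hom S u))
  ∷ All.map factor-vanishes (separators-vanish Y seps)
  where
  factor-vanishes : ∀ {v} → selector (separators seps) v ≡ 0ℤ →
                    (+ hom S v ℤ.- + hom S u) ℤ.* selector (separators seps) v ≡ 0ℤ
  factor-vanishes {v} vanishes =
    ≡-trans (cong ((+ hom S v ℤ.- + hom S u) ℤ.*_) vanishes) (ℤ.*-zeroʳ (+ hom S v ℤ.- + hom S u))

separators-nonzero : ∀ {t Y} (seps : All (Separableᵗ t) Y) → selector (separators seps) t ≢ 0ℤ
separators-nonzero []                     ()
separators-nonzero {t} {u ∷ _} ((S , S-separates) ∷ seps) product≡0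
  with ℤ.i*j≡0⇒i≡0∨j≡0 (+ hom S t ℤ.- + hom S u) product≡0
... | inj₁ factor≡0 = S-separates (ℤ.+-injective (ℤ.i-j≡0⇒i≡j (+ hom S t) (+ hom S u) factor≡0))
... | inj₂ rest≡0   = separators-nonzero seps rest≡0

weighted-leaf-++-self : ∀ gs u → weighted leaf (gs ++ gs) u ≡ selector gs u ℤ.* selector gs u
weighted-leaf-++-self gs u = begin
  + hom leaf u ℤ.* selector (gs ++ gs) u ≡⟨ cong (λ h → + h ℤ.* selector (gs ++ gs) u) (hom-leaf u) ⟩
  1ℤ ℤ.* selector (gs ++ gs) u           ≡⟨ ℤ.*-identityˡ (selector (gs ++ gs) u) ⟩
  selector (gs ++ gs) u                  ≡⟨ selector-++ gs gs u ⟩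
  selector gs u ℤ.* selector gs u        ∎

unmatched-sumsDisagree : ∀ t X Y (seps : All (Separableᵗ t) Y) →
                         ¬ SumsAgree (t ∷ X) Y (weighted leaf (separators seps ++ separators seps))
unmatched-sumsDisagree t X Y seps agree =
  ℤ.<-irrefl (sym (≡-trans squares-agree Y-vanishes)) t∷X-positive
  where
  s : Tree → ℤ
  s = selector (separators seps)
  square : Tree → ℤ
  square u = s u ℤ.* s u
  squares-agree : SumsAgree (t ∷ X) Y square
  squares-agree = sumsAgree-cong (t ∷ X) Y (λ u → sym (weighted-leaf-++-self (separators seps) u)) agree
  Y-vanishes : ∑ Y square ≡ 0ℤ
  Y-vanishes =
    ∑-zero Y (All.map (λ vanishes → cong₂ ℤ._*_ vanishes vanishes) (separators-vanish Y seps))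
  t∷X-positive : 0ℤ ℤ.< ∑ (t ∷ X) square
  t∷X-positive = ℤ.+-mono-<-≤ (square-positive (s t) (separators-nonzero seps))
                              (∑-nonNegative X (λ u → square-nonNegative (s u)))

unmatched-separable : ∀ t X Y → All (Separableᵗ t) Y → Separable (t ∷ X) Y
unmatched-separable t X Y seps
  with separable⊎weighted-sumsAgree (t ∷ X) Y (separators seps ++ separators seps) leaf
... | inj₁ sep   = sep
... | inj₂ agree = ⊥-elim (unmatched-sumsDisagree t X Y seps agree)

HasCopy : Tree → Forest → Set
HasCopy t Y = Σ[ u ∈ Tree ] Σ[ Y′ ∈ Forest ] t ≅ u × u ∷ Y′ ≋ Y

separable-∷ : ∀ {t u X Y} → t ≅ u → Separable X Y → Separable (t ∷ X) (u ∷ Y)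
separable-∷ {t} {u} {X} {Y} t≅u (S , S-separates) = S , λ counts≡ →
  S-separates (+-cancelˡ-≡ (hom S u) (homInto S X) (homInto S Y)
    (≡-trans (cong (_+ homInto S X) (sym (hom-cong S t≅u))) counts≡))

separable-respʳ-≋ : ∀ {X Y Z} → Y ≋ Z → Separable X Y → Separable X Z
separable-respʳ-≋ Y≋Z (S , S-separates) =
  S , λ counts≡ → S-separates (≡-trans counts≡ (sym (homInto-cong S Y≋Z)))

mutual
  ≋⊎separable : ∀ X Y → X ≋ Y ⊎ Separable X Y
  ≋⊎separable []      []      = inj₁ (≋-refl [])
  ≋⊎separable []      (u ∷ Y) =
    inj₂ (leaf , λ 0≡counts → 0≢1+n (≡-trans 0≡counts (cong (_+ homInto leaf Y) (hom-leaf u))))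
  ≋⊎separable (t ∷ X) Y with copy? t Y
  ... | inj₂ seps                  = inj₂ (unmatched-separable t X Y seps)
  ... | inj₁ (u , Y′ , t≅u , uY′≋Y) with ≋⊎separable X Y′
  ...   | inj₁ X≋Y′ = inj₁ (trans (prep t≅u X≋Y′) uY′≋Y)
  ...   | inj₂ sep  =
    inj₂ (separable-respʳ-≋ {X = t ∷ X} uY′≋Y (separable-∷ {X = X} {Y = Y′} t≅u sep))

  ≅⊎separableᵗ : ∀ t u → t ≅ u ⊎ Separableᵗ t u
  ≅⊎separableᵗ (node ts) (node us) with ≋⊎separable ts us
  ... | inj₁ ts≋us             = inj₁ (node ts≋us)
  ... | inj₂ (S , S-separates) = inj₂ (plant S , λ counts≡ →
    S-separates (≡-trans (sym (hom-plant S ts)) (≡-trans counts≡ (hom-plant S us))))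

  copy? : ∀ t Y → HasCopy t Y ⊎ All (Separableᵗ t) Y
  copy? t []      = inj₂ []
  copy? t (y ∷ Y) with ≅⊎separableᵗ t y
  ... | inj₁ t≅y = inj₁ (y , Y , t≅y , ≋-refl (y ∷ Y))
  ... | inj₂ sep with copy? t Y
  ...   | inj₂ seps                  = inj₂ (sep ∷ seps)
  ...   | inj₁ (u , Y′ , t≅u , uY′≋Y) = inj₁ (u , y ∷ Y′ , t≅u ,
          trans (swap (≅-refl u) (≅-refl y) (≋-refl Y′)) (prep (≅-refl y) uY′≋Y))

≤-⊔-sel : ∀ {n} a b → n ≤ a ⊔ b → n ≤ a ⊎ n ≤ b
≤-⊔-sel {n} a b n≤a⊔b with ⊔-sel a b
... | inj₁ a⊔b≡a = inj₁ (subst (n ≤_) a⊔b≡a n≤a⊔b)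
... | inj₂ a⊔b≡b = inj₂ (subst (n ≤_) a⊔b≡b n≤a⊔b)

childDepth-≤ : ∀ {n} ts → childDepth ts ≤ n → All (λ t → tdepth t < n) ts
childDepth-≤ []       _     = []
childDepth-≤ (t ∷ ts) ts≤n =
  m⊔n≤o⇒m≤o (suc (tdepth t)) (childDepth ts) ts≤n
  ∷ childDepth-≤ ts (m⊔n≤o⇒n≤o (suc (tdepth t)) (childDepth ts) ts≤n)

<-childDepth : ∀ {n} ts → n < childDepth ts → Any (λ t → n ≤ tdepth t) ts
<-childDepth (t ∷ ts) n<ts with ≤-⊔-sel (suc (tdepth t)) (childDepth ts) n<ts
... | inj₁ n<t  = here (s≤s⁻¹ n<t)
... | inj₂ n<ts = there (<-childDepth ts n<ts)

mutual
  hom-positive : ∀ S t → tdepth S ≤ tdepth t → 0 < hom S t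
  hom-positive (node ss) (node ts) = homEach-positive ss ts

  homEach-positive : ∀ ss ts → childDepth ss ≤ childDepth ts → 0 < homEach ss ts
  homEach-positive []       ts _     = s≤s z≤n
  homEach-positive (s ∷ ss) ts ss≤ts = *-mono-<
    (homInto-positive s ts (<-childDepth ts (m⊔n≤o⇒m≤o (suc (tdepth s)) (childDepth ss) ss≤ts)))
    (homEach-positive ss ts (m⊔n≤o⇒n≤o (suc (tdepth s)) (childDepth ss) ss≤ts))

  homInto-positive : ∀ S X → Any (λ x → tdepth S ≤ tdepth x) X → 0 < homInto S X
  homInto-positive S (x ∷ X) (here S≤x) = ≤-trans (hom-positive S x S≤x) (m≤m+n _ _)
  homInto-positive S (x ∷ X) (there S≤X) = ≤-trans (homInto-positive S X S≤X) (m≤n+m _ _)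

mutual
  hom-zero : ∀ S t → tdepth t < tdepth S → hom S t ≡ 0
  hom-zero (node ss) (node ts) ts<ss = homEach-zero ss ts (<-childDepth ss ts<ss)

  homEach-zero : ∀ ss ts → Any (λ s → childDepth ts ≤ tdepth s) ss → homEach ss ts ≡ 0
  homEach-zero (s ∷ ss) ts (here ts≤s) =
    cong (_* homEach ss ts) (homInto-zero s ts (childDepth-≤ ts ts≤s))
  homEach-zero (s ∷ ss) ts (there ts≤ss) =
    ≡-trans (cong (homInto s ts *_) (homEach-zero ss ts ts≤ss)) (*-zeroʳ (homInto s ts))

  homInto-zero : ∀ S X → All (λ x → tdepth x < tdepth S) X → homInto S X ≡ 0
  homInto-zero S []      []            = ≡-refl
  homInto-zero S (x ∷ X) (x<S ∷ X<S) = cong₂ _+_ (hom-zero S x x<S) (homInto-zero S X X<S)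

⊔⊥-lub⁻¹ : ∀ p q {r} → p ⊔⊥ q ≤⊥ r → p ≤⊥ r × q ≤⊥ r
⊔⊥-lub⁻¹ nothing  q        q≤r         = -∞≤ , q≤r
⊔⊥-lub⁻¹ (just m) nothing  m≤r         = m≤r , -∞≤
⊔⊥-lub⁻¹ (just m) (just n) (just≤ m⊔n≤r) =
  just≤ (m⊔n≤o⇒m≤o m n m⊔n≤r) , just≤ (m⊔n≤o⇒n≤o m n m⊔n≤r)

≤⊥-⊔⊥-sel : ∀ {n} p q → just n ≤⊥ p ⊔⊥ q → just n ≤⊥ p ⊎ just n ≤⊥ q
≤⊥-⊔⊥-sel nothing  q        n≤q           = inj₂ n≤q
≤⊥-⊔⊥-sel (just m) nothing  n≤m           = inj₁ n≤m
≤⊥-⊔⊥-sel (just m) (just k) (just≤ n≤m⊔k) with ≤-⊔-sel m k n≤m⊔k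
... | inj₁ n≤m = inj₁ (just≤ n≤m)
... | inj₂ n≤k = inj₂ (just≤ n≤k)

just-≤⊥? : ∀ n p → Dec (just n ≤⊥ p)
just-≤⊥? n nothing  = no λ ()
just-≤⊥? n (just m) = Dec.map′ just≤ (λ { (just≤ n≤m) → n≤m }) (n ≤? m)

≤⊥-≰⊥⇒< : ∀ {m n p} → just m ≤⊥ p → ¬ just n ≤⊥ p → m < n
≤⊥-≰⊥⇒< (just≤ m≤p) n≰p = ≤-<-trans m≤p (≰⇒> (λ n≤p → n≰p (just≤ n≤p)))

fdepth-≤⊥ : ∀ {r} X → fdepth X ≤⊥ r → All (λ x → just (tdepth x) ≤⊥ r) X
fdepth-≤⊥ []      _   = []
fdepth-≤⊥ (x ∷ X) X≤r with ⊔⊥-lub⁻¹ (just (tdepth x)) (fdepth X) X≤r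
... | x≤r , rest≤r = x≤r ∷ fdepth-≤⊥ X rest≤r

≤⊥-fdepth : ∀ {n} X → just n ≤⊥ fdepth X → Any (λ x → n ≤ tdepth x) X
≤⊥-fdepth (x ∷ X) n≤X with ≤⊥-⊔⊥-sel (just (tdepth x)) (fdepth X) n≤X
... | inj₁ (just≤ n≤x) = here n≤x
... | inj₂ n≤rest      = there (≤⊥-fdepth X n≤rest)

≤⊥-dmax : ∀ {n} As → just n ≤⊥ dmax As → Any (λ A → just n ≤⊥ fdepth A) As
≤⊥-dmax (A ∷ As) n≤As with ≤⊥-⊔⊥-sel (fdepth A) (dmax As) n≤As
... | inj₁ n≤A    = here n≤A
... | inj₂ n≤rest = there (≤⊥-dmax As n≤rest)

homInto-shallow : ∀ {r} S X → fdepth X ≤⊥ r → ¬ just (tdepth S) ≤⊥ r → homInto S X ≡ 0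
homInto-shallow S X X≤r S≰r =
  homInto-zero S X (All.map (λ x≤r → ≤⊥-≰⊥⇒< x≤r S≰r) (fdepth-≤⊥ X X≤r))

homInto-deep : ∀ S X → just (tdepth S) ≤⊥ fdepth X → 0 < homInto S X
homInto-deep S X S≤X = homInto-positive S X (≤⊥-fdepth X S≤X)

polyFromℕ : ℕ → List ℕ → ℕ → ℕ
polyFromℕ k []       x = 0
polyFromℕ k (a ∷ as) x = a * x ^ suc k + polyFromℕ (suc k) as x

homInto-polyFrom : ∀ S k As X →
                   homInto S (polyFrom k As X) ≡ polyFromℕ k (map (homInto S) As) (homInto S X)
homInto-polyFrom S k []       X = ≡-refl
homInto-polyFrom S k (A ∷ As) X = begin
  homInto S (A ⊛ pow X k ++ polyFrom (suc k) As X)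
    ≡⟨ homInto-++ S (A ⊛ pow X k) (polyFrom (suc k) As X) ⟩
  homInto S (A ⊛ pow X k) + homInto S (polyFrom (suc k) As X)
    ≡⟨ cong₂ _+_ (≡-trans (homInto-⊛ S A (pow X k)) (cong (homInto S A *_) (homInto-pow S X k)))
                 (homInto-polyFrom S (suc k) As X) ⟩
  homInto S A * homInto S X ^ suc k + polyFromℕ (suc k) (map (homInto S) As) (homInto S X) ∎

homInto-evalPoly : ∀ S A₀ As X → homInto S (evalPoly A₀ As X)
                   ≡ homInto S A₀ + polyFromℕ 0 (map (homInto S) As) (homInto S X)
homInto-evalPoly S A₀ As X = ≡-trans (homInto-++ S A₀ (polyFrom 0 As X))
                                     (cong (λ n → homInto S A₀ + n) (homInto-polyFrom S 0 As X))

polyFromℕ-mono-≤ : ∀ k as {x y} → x ≤ y → polyFromℕ k as x ≤ polyFromℕ k as y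
polyFromℕ-mono-≤ k []       x≤y = z≤n
polyFromℕ-mono-≤ k (a ∷ as) x≤y =
  +-mono-≤ (*-monoʳ-≤ a (^-monoˡ-≤ (suc k) x≤y)) (polyFromℕ-mono-≤ (suc k) as x≤y)

polyFromℕ-mono-< : ∀ k as {x y} → Any (0 <_) as → x < y → polyFromℕ k as x < polyFromℕ k as y
polyFromℕ-mono-< k (a ∷ as) (here a>0) x<y =
  +-mono-<-≤ (*-monoʳ-< a {{>-nonZero a>0}} (^-monoˡ-< (suc k) x<y))
             (polyFromℕ-mono-≤ (suc k) as (<⇒≤ x<y))
polyFromℕ-mono-< k (a ∷ as) (there as>0) x<y =
  +-mono-≤-< (*-monoʳ-≤ a (^-monoˡ-≤ (suc k) (<⇒≤ x<y))) (polyFromℕ-mono-< (suc k) as as>0 x<y)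

polyFromℕ-injective : ∀ k as {x y} → Any (0 <_) as → polyFromℕ k as x ≡ polyFromℕ k as y → x ≡ y
polyFromℕ-injective k as {x} {y} as>0 px≡py with <-cmp x y
... | tri< x<y _ _ = ⊥-elim (<-irrefl px≡py (polyFromℕ-mono-< k as as>0 x<y))
... | tri≈ _ x≡y _ = x≡y
... | tri> _ _ y<x = ⊥-elim (<-irrefl (sym px≡py) (polyFromℕ-mono-< k as as>0 y<x))

proposition35 : (A₀ : Forest) (As : List Forest) →
    fdepth A₀ ≤⊥ dmax As →
    (X Y : Forest) → fdepth X ≤⊥ dmax As → fdepth Y ≤⊥ dmax As →
    evalPoly A₀ As X ≋ evalPoly A₀ As Y → X ≋ Y
proposition35 A₀ As _ X Y X≤ Y≤ PX≋PY with ≋⊎separable X Y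
... | inj₁ X≋Y               = X≋Y
... | inj₂ (S , S-separates) = ⊥-elim (S-separates same-count)
  where
  cs : List ℕ
  cs = map (homInto S) As
  same-value : polyFromℕ 0 cs (homInto S X) ≡ polyFromℕ 0 cs (homInto S Y)
  same-value = +-cancelˡ-≡ (homInto S A₀) _ _ (begin
    homInto S A₀ + polyFromℕ 0 cs (homInto S X) ≡⟨ homInto-evalPoly S A₀ As X ⟨
    homInto S (evalPoly A₀ As X)                ≡⟨ homInto-cong S PX≋PY ⟩
    homInto S (evalPoly A₀ As Y)                ≡⟨ homInto-evalPoly S A₀ As Y ⟩
    homInto S A₀ + polyFromℕ 0 cs (homInto S Y) ∎)
  same-count : homInto S X ≡ homInto S Y
  same-count with just-≤⊥? (tdepth S) (dmax As)
  ... | yes S≤As = polyFromℕ-injective 0 cs positive-coefficient same-value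
    where
    positive-coefficient : Any (0 <_) cs
    positive-coefficient = Any.map⁺ (Any.map (λ {A} → homInto-deep S A) (≤⊥-dmax As S≤As))
  ... | no  S≰As = ≡-trans (homInto-shallow S X X≤ S≰As) (sym (homInto-shallow S Y Y≤ S≰As))
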